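{- Let $n\ge 3$ and let $P(G(n))$ be the power graph of the gyrogroup $(G(n),\oplus)$ described in the context. Then the characteristic polynomial $\det(xI-A)$ of the adjacency matrix $A$ of $P(G(n))$ is $$x^{2^{n-1}-1}(1+x)^{2^{n-1}-2}\left[x^3+(2-2^{n-1})x^2+(1-2^n)x+2^{2n-2}-2^n\right].$$
   Context: Let $n\ge 3$ and $m=2^{n-1}$. Put $P(n)=\{0,1,\dots,m-1\}$, $H(n)=\{m,m+1,\dots,2^n-1\}$ and $G(n)=P(n)\cup H(n)$. Define a binary operation $\oplus$ on $G(n)$ by: $i\oplus j=t$ if $(i,j)\in P(n)\times P(n)$; $i\oplus j=t+m$ if $(i,j)\in P(n)\times H(n)$; $i\oplus j=s+m$ if $(i,j)\in H(n)\times P(n)$; $i\oplus j=k$ if $(i,j)\in H(n)\times H(n)$, where $t,s,k\in P(n)$ are determined by $t\equiv i+j$, $s\equiv i+(\tfrac m2-1)j$, $k\equiv(\tfrac m2+1)i+(\tfrac m2-1)j \pmod m$. Then $(G(n),\oplus)$ is a gyrogroup with identity $e=0$. Powers are defined by $a^1=a$, $a^{k+1}=a\oplus a^k$. The power graph $P(G(n))$ is the simple undirected graph with vertex set $G(n)$ in which two distinct vertices $u,v$ are adjacent if and only if $u^k=v$ or $v^k=u$ for some positive integer $k$. -}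

module Defs where

open import Data.Nat as ℕ using (ℕ; zero; suc; _+_; _*_; _∸_; _^_; _<ᵇ_; _/_; _%_; NonZero)
open import Data.Nat.Properties using (m^n≢0)
open import Data.Bool using (Bool; true; false; if_then_else_)
open import Data.Fin using (Fin; zero; suc; toℕ; punchIn)
open import Data.Integer as ℤ using (ℤ)
open import Data.Product using (∃; _×_; _,_)
open import Data.Sum using (_⊎_)
open import Relation.Binary.PropositionalEquality using (_≡_)
open import Relation.Nullary using (¬_)

half : ℕ → ℕ
half n = 2 ^ (n ∸ 1)

modH : ℕ → ℕ → ℕ
modH n a = _%_ a (half n) {{m^n≢0 2 (n ∸ 1)}}

-- The gyrogroup operation ⊕ on G(n) = {0,…,2^n - 1} (elements as naturals).
-- P(n) = {0,…,m-1}, H(n) = {m,…,2^n - 1}.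
oplus : (n : ℕ) → ℕ → ℕ → ℕ
oplus n i j with i <ᵇ half n | j <ᵇ half n
... | true  | true  = modH n (i + j)
... | true  | false = modH n (i + j) + half n
... | false | true  = modH n (i + (half n / 2 ∸ 1) * j) + half n
... | false | false = modH n ((half n / 2 + 1) * i + (half n / 2 ∸ 1) * j)

-- a^1 = a, a^(k+1) = a ⊕ a^k ; gpow n a k = a^(k+1)
gpow : (n : ℕ) → ℕ → ℕ → ℕ
gpow n a zero    = a
gpow n a (suc k) = oplus n a (gpow n a k)

PowerAdj : (n : ℕ) → Fin (2 ^ n) → Fin (2 ^ n) → Set
PowerAdj n u v =
  ¬ (u ≡ v) ×
  ((∃ λ k → gpow n (toℕ u) k ≡ toℕ v) ⊎ (∃ λ k → gpow n (toℕ v) k ≡ toℕ u))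

IsAdjMatrix : (n : ℕ) → (Fin (2 ^ n) → Fin (2 ^ n) → ℤ) → Set
IsAdjMatrix n A = ∀ u v →
  (PowerAdj n u v → A u v ≡ ℤ.1ℤ) × (¬ PowerAdj n u v → A u v ≡ ℤ.0ℤ)

sumFin : ∀ {k} → (Fin k → ℤ) → ℤ
sumFin {zero}  f = ℤ.0ℤ
sumFin {suc k} f = f zero ℤ.+ sumFin (λ i → f (suc i))

det : ∀ {k} → (Fin k → Fin k → ℤ) → ℤ
det {zero}  M = ℤ.1ℤ
det {suc k} M = sumFin (λ j →
  (ℤ.-1ℤ ℤ.^ toℕ j) ℤ.* (M zero j ℤ.* det (λ r c → M (suc r) (punchIn j c))))

charMat : ∀ {k} → ℤ → (Fin k → Fin k → ℤ) → Fin k → Fin k → ℤ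
charMat x A i j with i Data.Fin.≟ j
... | Relation.Nullary.yes _ = x ℤ.- A i j
... | Relation.Nullary.no  _ = ℤ.- A i j

-- The subgroup P ≅ ℤ/m of G(n) is a cyclic 2-group, so of any two of its elements one is a
-- multiple (a power) of the other, whereas every h ∈ H satisfies h ⊕ h = 0 and h ⊕ 0 = h.
-- Hence two distinct vertices are adjacent exactly when both lie in P or one of them is 0:
-- the power graph is the complete graph on P with one pendant vertex per h ∈ H attached to 0.
-- Adding the H-rows to x times the first row of xI - A leaves a block lower triangular matrix
-- with diagonal blocks x I_m and xI - A(K_m) with first row (x² - m, -x, …, -x), so that
-- x det(xI - A) = x^m (x det(xI - A(K_m)) - m det(xI - A(K_{m-1}))); for x = 0 two H-rows agree.

module Submission where

open import Defs
open import Data.Nat using (ℕ)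
open import Data.Integer using (ℤ)

module Determinant where

  open import Data.Nat as ℕ using (zero; suc)
  open import Data.Fin using (Fin; zero; suc; toℕ; punchIn; _↑ˡ_; _↑ʳ_)
  open import Data.Fin.Properties as Finₚ using (suc-injective)
  open import Data.Integer using (_+_; _-_; _*_; -_; 0ℤ; 1ℤ; -1ℤ)
  import Data.Integer.Properties as ℤₚ
  open import Data.Integer.Tactic.RingSolver using (solve-∀)
  open import Algebra.Properties.Semiring.Sum ℤₚ.+-*-semiring
    using (sum; sum-cong-≗; ∑-distrib-+; *-distribˡ-sum; sum-replicate-zero)
  open import Algebra.Properties.AbelianGroup ℤₚ.+-0-abelianGroup using (inverseʳ-unique)
  open import Data.Empty using (⊥-elim)
  open import Function using (_∘_)
  open import Relation.Binary.PropositionalEquality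
  open ≡-Reasoning

  Matrix : ℕ → Set
  Matrix k = Fin k → Fin k → ℤ

  sign : ∀ {k} → Fin k → ℤ
  sign j = -1ℤ Data.Integer.^ toℕ j

  minor : ∀ {k} → Matrix (suc k) → Fin (suc k) → Matrix k
  minor M j r c = M (suc r) (punchIn j c)

  term : ∀ {k} → Matrix (suc k) → Fin (suc k) → ℤ
  term M j = sign j * (M zero j * det (minor M j))

  sumFin≡sum : ∀ {k} (f : Fin k → ℤ) → sumFin f ≡ sum f
  sumFin≡sum {zero}  f = refl
  sumFin≡sum {suc k} f = cong (_+_ (f zero)) (sumFin≡sum (λ i → f (suc i)))

  sumFin-cong : ∀ {k} {f g : Fin k → ℤ} → f ≗ g → sumFin f ≡ sumFin g
  sumFin-cong {f = f} {g} f≗g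
    rewrite sumFin≡sum f | sumFin≡sum g = sum-cong-≗ f≗g

  sumFin-distrib-+ : ∀ {k} (f g : Fin k → ℤ) → sumFin (λ i → f i + g i) ≡ sumFin f + sumFin g
  sumFin-distrib-+ f g
    rewrite sumFin≡sum (λ i → f i + g i) | sumFin≡sum f | sumFin≡sum g = ∑-distrib-+ f g

  *-distribˡ-sumFin : ∀ {k} a (f : Fin k → ℤ) → sumFin (λ i → a * f i) ≡ a * sumFin f
  *-distribˡ-sumFin a f
    rewrite sumFin≡sum (λ i → a * f i) | sumFin≡sum f = sym (*-distribˡ-sum a f)

  sumFin-zero : ∀ {k} {f : Fin k → ℤ} → (∀ i → f i ≡ 0ℤ) → sumFin f ≡ 0ℤ
  sumFin-zero {k} {f} f≗0 rewrite sumFin≡sum f = trans (sum-cong-≗ f≗0) (sum-replicate-zero k)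

  sumFin-↑ : ∀ a {b} (f : Fin (a ℕ.+ b) → ℤ) →
             sumFin f ≡ sumFin (λ i → f (i ↑ˡ b)) + sumFin (λ i → f (a ↑ʳ i))
  sumFin-↑ zero    f = sym (ℤₚ.+-identityˡ _)
  sumFin-↑ (suc a) f = trans (cong (_+_ (f zero)) (sumFin-↑ a (λ i → f (suc i))))
                             (sym (ℤₚ.+-assoc (f zero) _ _))

  x*[y*0]≡0 : ∀ x y → x * (y * 0ℤ) ≡ 0ℤ
  x*[y*0]≡0 = solve-∀

  x*[0*y]≡0 : ∀ x y → x * (0ℤ * y) ≡ 0ℤ
  x*[0*y]≡0 = solve-∀

  term-entry≡0 : ∀ {k} (M : Matrix (suc k)) j → M zero j ≡ 0ℤ → term M j ≡ 0ℤ
  term-entry≡0 M j M₀ⱼ≡0 =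
    trans (cong (λ z → sign j * (z * det (minor M j))) M₀ⱼ≡0) (x*[0*y]≡0 (sign j) (det (minor M j)))

  term-minor≡0 : ∀ {k} (M : Matrix (suc k)) j → det (minor M j) ≡ 0ℤ → term M j ≡ 0ℤ
  term-minor≡0 M j minor≡0 =
    trans (cong (λ z → sign j * (M zero j * z)) minor≡0) (x*[y*0]≡0 (sign j) (M zero j))

  det-cong : ∀ {k} {M N : Matrix k} → (∀ r c → M r c ≡ N r c) → det M ≡ det N
  det-cong {zero}  M≗N = refl
  det-cong {suc k} M≗N = sumFin-cong λ j →
    cong₂ (λ a b → sign j * (a * b)) (M≗N zero j) (det-cong λ r c → M≗N (suc r) (punchIn j c))

  Extensional : ∀ {a b} → ((Fin a → Fin b) → ℤ) → Set
  Extensional D = ∀ {φ ψ} → φ ≗ ψ → D φ ≡ D ψ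

  lift : ∀ {a b} → (Fin a → Fin b) → Fin (suc a) → Fin (suc b)
  lift φ zero    = zero
  lift φ (suc c) = suc (φ c)

  -- Laplace expansion along the first two rows when both are equal to r; D φ stands for the
  -- determinant of the remaining rows restricted to the columns φ.
  pairExpansion : ∀ p → (Fin (suc (suc p)) → ℤ) → ((Fin p → Fin (suc (suc p))) → ℤ) → ℤ
  pairExpansion p r D = sumFin λ j → sign j * (r j * sumFin λ k →
    sign k * (r (punchIn j k) * D (λ c → punchIn j (punchIn k c))))

  shiftedPairExpansion : ∀ p → (Fin (suc (suc p)) → ℤ) → ((Fin p → Fin (suc (suc p))) → ℤ) → ℤ
  shiftedPairExpansion p r D = sumFin λ j → sign j * (r (suc j) * sumFin λ k →
    sign k * (r (suc (punchIn j k)) * D (λ c → punchIn (suc j) (punchIn (suc k) c))))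

  pairExpansion≡0 : ∀ p r D → Extensional D → pairExpansion p r D ≡ 0ℤ
  shiftedPairExpansion≡0 : ∀ p r D → Extensional D → shiftedPairExpansion p r D ≡ 0ℤ

  shiftedPairExpansion≡0 zero    r D D-ext = sumFin-zero λ j → x*[y*0]≡0 (sign j) (r (suc j))
  shiftedPairExpansion≡0 (suc p) r D D-ext = trans
    (sumFin-cong λ j → cong (λ z → sign j * (r (suc j) * z)) (sumFin-cong λ k →
      cong (λ z → sign k * (r (suc (punchIn j k)) * z)) (D-ext (punchIn-suc-lift j k))))
    (pairExpansion≡0 p (λ i → r (suc i)) (λ φ → D (lift φ))
      (λ φ≗ψ → D-ext λ { zero → refl ; (suc c) → cong suc (φ≗ψ c) }))
    where
    punchIn-suc-lift : ∀ j k → (λ c → punchIn (suc j) (punchIn (suc k) c))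
                                 ≗ lift (λ c → punchIn j (punchIn {p} k c))
    punchIn-suc-lift j k zero    = refl
    punchIn-suc-lift j k (suc c) = refl

  -- The j = 0 summand and the k = 0 summands of the j > 0 summands cancel;
  -- what is left is the shifted expansion.
  pairExpansion≡0 p r D D-ext = begin
    pairExpansion p r D
      ≡⟨ cong (_+_ (1ℤ * (r zero * A))) (sumFin-cong split) ⟩
    1ℤ * (r zero * A) + sumFin (λ j → (-1ℤ * r zero) * t j + h j)
      ≡⟨ cong (_+_ (1ℤ * (r zero * A))) (sumFin-distrib-+ (λ j → (-1ℤ * r zero) * t j) h) ⟩
    1ℤ * (r zero * A) + (sumFin (λ j → (-1ℤ * r zero) * t j) + sumFin h)
      ≡⟨ cong₂ (λ u v → 1ℤ * (r zero * A) + (u + v))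
           (*-distribˡ-sumFin (-1ℤ * r zero) t) (shiftedPairExpansion≡0 p r D D-ext) ⟩
    1ℤ * (r zero * A) + ((-1ℤ * r zero) * A + 0ℤ)
      ≡⟨ cancel (r zero) A ⟩
    0ℤ ∎
    where
    t : Fin (suc p) → ℤ
    t k = sign k * (r (suc k) * D (λ c → suc (punchIn k c)))
    A : ℤ
    A = sumFin t
    g : Fin (suc p) → Fin p → ℤ
    g j k = r (suc (punchIn j k)) * D (λ c → punchIn (suc j) (punchIn (suc k) c))
    h : Fin (suc p) → ℤ
    h j = sign j * (r (suc j) * sumFin (λ k → sign k * g j k))
    cancel : ∀ a b → 1ℤ * (a * b) + ((-1ℤ * a) * b + 0ℤ) ≡ 0ℤ
    cancel = solve-∀
    regroup : ∀ s rj r0 d S → (-1ℤ * s) * (rj * (1ℤ * (r0 * d) + -1ℤ * S))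
                              ≡ (-1ℤ * r0) * (s * (rj * d)) + s * (rj * S)
    regroup = solve-∀
    negate : ∀ s x → (-1ℤ * s) * x ≡ -1ℤ * (s * x)
    negate = solve-∀
    split : ∀ j → (-1ℤ * sign j) * (r (suc j) * (1ℤ * (r zero * D (λ c → suc (punchIn j c)))
                    + sumFin (λ k → (-1ℤ * sign k) * g j k)))
                  ≡ (-1ℤ * r zero) * t j + h j
    split j = begin
      (-1ℤ * sign j) * (r (suc j) * (1ℤ * (r zero * D (λ c → suc (punchIn j c)))
        + sumFin (λ k → (-1ℤ * sign k) * g j k)))
        ≡⟨ cong (λ z → (-1ℤ * sign j) * (r (suc j) * (1ℤ * (r zero * D (λ c → suc (punchIn j c))) + z)))
             (trans (sumFin-cong λ k → negate (sign k) (g j k)) (*-distribˡ-sumFin -1ℤ (λ k → sign k * g j k))) ⟩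
      (-1ℤ * sign j) * (r (suc j) * (1ℤ * (r zero * D (λ c → suc (punchIn j c)))
        + -1ℤ * sumFin (λ k → sign k * g j k)))
        ≡⟨ regroup (sign j) (r (suc j)) (r zero) _ _ ⟩
      (-1ℤ * r zero) * t j + h j ∎

  det-rows₀₁≡⇒0 : ∀ {p} (M : Matrix (suc (suc p))) → (∀ c → M (suc zero) c ≡ M zero c) → det M ≡ 0ℤ
  det-rows₀₁≡⇒0 M row₁≡row₀ = trans
    (sumFin-cong λ j → cong (λ z → sign j * (M zero j * z)) (sumFin-cong λ k →
      cong (λ z → sign k * (z * det (λ r c → M (suc (suc r)) (punchIn j (punchIn k c))))) (row₁≡row₀ (punchIn j k))))
    (pairExpansion≡0 _ (M zero) (λ φ → det (λ r c → M (suc (suc r)) (φ c)))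
      (λ φ≗ψ → det-cong λ r c → cong (M (suc (suc r))) (φ≗ψ c)))

  sumFin-linear : ∀ {k} a b (f g : Fin k → ℤ) →
                  sumFin (λ j → a * f j + b * g j) ≡ a * sumFin f + b * sumFin g
  sumFin-linear a b f g = trans (sumFin-distrib-+ (λ j → a * f j) (λ j → b * g j))
                                (cong₂ _+_ (*-distribˡ-sumFin a f) (*-distribˡ-sumFin b g))

  det-linear-row₀ : ∀ {k} (M N L : Matrix (suc k)) a b →
    (∀ c → L zero c ≡ a * M zero c + b * N zero c) →
    (∀ r c → L (suc r) c ≡ M (suc r) c) → (∀ r c → L (suc r) c ≡ N (suc r) c) →
    det L ≡ a * det M + b * det N
  det-linear-row₀ M N L a b L₀ L≗M L≗N = trans (sumFin-cong expand) (sumFin-linear a b (term M) (term N))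
    where
    distrib : ∀ s a m b n d → s * ((a * m + b * n) * d) ≡ a * (s * (m * d)) + b * (s * (n * d))
    distrib = solve-∀
    expand : ∀ j → term L j ≡ a * term M j + b * term N j
    expand j = begin
      sign j * (L zero j * det (minor L j))
        ≡⟨ cong (λ z → sign j * (z * det (minor L j))) (L₀ j) ⟩
      sign j * ((a * M zero j + b * N zero j) * det (minor L j))
        ≡⟨ distrib (sign j) a (M zero j) b (N zero j) (det (minor L j)) ⟩
      a * (sign j * (M zero j * det (minor L j))) + b * (sign j * (N zero j * det (minor L j)))
        ≡⟨ cong₂ (λ u v → a * (sign j * (M zero j * u)) + b * (sign j * (N zero j * v)))
             (det-cong λ r c → L≗M r (punchIn j c)) (det-cong λ r c → L≗N r (punchIn j c)) ⟩
      a * (sign j * (M zero j * det (minor M j))) + b * (sign j * (N zero j * det (minor N j))) ∎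

  det-linear-row : ∀ {k} (i : Fin k) (M N L : Matrix k) a b →
    (∀ c → L i c ≡ a * M i c + b * N i c) →
    (∀ r → r ≢ i → ∀ c → L r c ≡ M r c) → (∀ r → r ≢ i → ∀ c → L r c ≡ N r c) →
    det L ≡ a * det M + b * det N
  det-linear-row zero M N L a b Lᵢ L≗M L≗N =
    det-linear-row₀ M N L a b Lᵢ (λ r → L≗M (suc r) λ ()) (λ r → L≗N (suc r) λ ())
  det-linear-row (suc i) M N L a b Lᵢ L≗M L≗N = trans (sumFin-cong expand) (sumFin-linear a b (term M) (term N))
    where
    distrib : ∀ s l a b d e → s * (l * (a * d + b * e)) ≡ a * (s * (l * d)) + b * (s * (l * e))
    distrib = solve-∀
    off : ∀ {r} → r ≢ i → suc r ≢ suc i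
    off r≢i = r≢i ∘ suc-injective
    expand : ∀ j → term L j ≡ a * term M j + b * term N j
    expand j = begin
      sign j * (L zero j * det (minor L j))
        ≡⟨ cong (λ z → sign j * (L zero j * z))
             (det-linear-row i (minor M j) (minor N j) (minor L j) a b (λ c → Lᵢ (punchIn j c))
               (λ r r≢i c → L≗M (suc r) (off r≢i) (punchIn j c))
               (λ r r≢i c → L≗N (suc r) (off r≢i) (punchIn j c))) ⟩
      sign j * (L zero j * (a * det (minor M j) + b * det (minor N j)))
        ≡⟨ distrib (sign j) (L zero j) a b _ _ ⟩
      a * (sign j * (L zero j * det (minor M j))) + b * (sign j * (L zero j * det (minor N j)))
        ≡⟨ cong₂ (λ u v → a * (sign j * (u * det (minor M j))) + b * (sign j * (v * det (minor N j))))
             (L≗M zero (λ ()) j) (L≗N zero (λ ()) j) ⟩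
      a * (sign j * (M zero j * det (minor M j))) + b * (sign j * (N zero j * det (minor N j))) ∎

  withRows₀₁ : ∀ {p} → (u v : Fin (suc (suc p)) → ℤ) → Matrix (suc (suc p)) → Matrix (suc (suc p))
  withRows₀₁ u v M zero          = u
  withRows₀₁ u v M (suc zero)    = v
  withRows₀₁ u v M (suc (suc r)) = M (suc (suc r))

  det-swap₀₁ : ∀ {p} (M : Matrix (suc (suc p))) → det (withRows₀₁ (M (suc zero)) (M zero) M) ≡ - det M
  det-swap₀₁ M = inverseʳ-unique (det M) (det (W v u)) (sym (begin
    0ℤ                                        ≡⟨ sym (det-repeated (u ⊕ v)) ⟩
    det (W (u ⊕ v) (u ⊕ v))                    ≡⟨ linear₀ (u ⊕ v) ⟩
    1ℤ * det (W u (u ⊕ v)) + 1ℤ * det (W v (u ⊕ v))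
      ≡⟨ cong₂ (λ a b → 1ℤ * a + 1ℤ * b) (linear₁ u) (linear₁ v) ⟩
    1ℤ * (1ℤ * det (W u u) + 1ℤ * det (W u v)) + 1ℤ * (1ℤ * det (W v u) + 1ℤ * det (W v v))
      ≡⟨ cong₂ (λ a b → 1ℤ * (1ℤ * a + 1ℤ * det (W u v)) + 1ℤ * (1ℤ * det (W v u) + 1ℤ * b))
           (det-repeated u) (det-repeated v) ⟩
    1ℤ * (1ℤ * 0ℤ + 1ℤ * det (W u v)) + 1ℤ * (1ℤ * det (W v u) + 1ℤ * 0ℤ)
      ≡⟨ simplify (det (W u v)) (det (W v u)) ⟩
    det (W u v) + det (W v u)                 ≡⟨ cong (_+ det (W v u)) (det-cong W≗M) ⟩
    det M + det (W v u) ∎))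
    where
    u v : Fin _ → ℤ
    u = M zero
    v = M (suc zero)
    _⊕_ : (Fin _ → ℤ) → (Fin _ → ℤ) → Fin _ → ℤ
    (w ⊕ w′) c = w c + w′ c
    W : (Fin _ → ℤ) → (Fin _ → ℤ) → Matrix _
    W w₀ w₁ = withRows₀₁ w₀ w₁ M
    W≗M : ∀ r c → W u v r c ≡ M r c
    W≗M zero          c = refl
    W≗M (suc zero)    c = refl
    W≗M (suc (suc r)) c = refl
    plus : ∀ a b → a + b ≡ 1ℤ * a + 1ℤ * b
    plus = solve-∀
    simplify : ∀ a b → 1ℤ * (1ℤ * 0ℤ + 1ℤ * a) + 1ℤ * (1ℤ * b + 1ℤ * 0ℤ) ≡ a + b
    simplify = solve-∀
    det-repeated : ∀ w → det (W w w) ≡ 0ℤ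
    det-repeated w = det-rows₀₁≡⇒0 (W w w) λ _ → refl
    linear₀ : ∀ w → det (W (u ⊕ v) w) ≡ 1ℤ * det (W u w) + 1ℤ * det (W v w)
    linear₀ w = det-linear-row₀ (W u w) (W v w) (W (u ⊕ v) w) 1ℤ 1ℤ (λ c → plus (u c) (v c)) below below
      where below : ∀ {w₀ w₀′} r c → W w₀ w (suc r) c ≡ W w₀′ w (suc r) c
            below zero    c = refl
            below (suc r) c = refl
    linear₁ : ∀ w → det (W w (u ⊕ v)) ≡ 1ℤ * det (W w u) + 1ℤ * det (W w v)
    linear₁ w = det-linear-row (suc zero) (W w u) (W w v) (W w (u ⊕ v)) 1ℤ 1ℤ (λ c → plus (u c) (v c)) off off
      where off : ∀ {w₁ w₁′} r → r ≢ suc zero → ∀ c → W w w₁ r c ≡ W w w₁′ r c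
            off zero          _   c = refl
            off (suc zero)    r≢1 c = ⊥-elim (r≢1 refl)
            off (suc (suc r)) _   c = refl

  det-row₀≡⇒0 : ∀ {k} (j : Fin k) (M : Matrix (suc k)) → (∀ c → M (suc j) c ≡ M zero c) → det M ≡ 0ℤ
  det-row₀≡⇒0 zero    M rows≡ = det-rows₀₁≡⇒0 M rows≡
  det-row₀≡⇒0 (suc j) M rows≡ = begin
    det M      ≡⟨ sym (ℤₚ.neg-involutive (det M)) ⟩
    - - det M  ≡⟨ cong -_ (sym (det-swap₀₁ M)) ⟩
    - det N    ≡⟨ cong -_ (sumFin-zero λ c → term-minor≡0 N c (minor≡0 c)) ⟩
    - 0ℤ       ≡⟨⟩
    0ℤ ∎
    where
    N = withRows₀₁ (M (suc zero)) (M zero) M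
    -- after the swap, row 1 repeats row j + 2, i.e. rows 0 and j + 1 of every minor agree
    minor≡0 : ∀ c → det (minor N c) ≡ 0ℤ
    minor≡0 c = det-row₀≡⇒0 j (minor N c) λ c′ → rows≡ (punchIn c c′)

  det-rows≡⇒0 : ∀ {k} (i j : Fin k) → i ≢ j → (M : Matrix k) → (∀ c → M j c ≡ M i c) → det M ≡ 0ℤ
  det-rows≡⇒0 zero    zero    i≢j M rows≡ = ⊥-elim (i≢j refl)
  det-rows≡⇒0 zero    (suc j) i≢j M rows≡ = det-row₀≡⇒0 j M rows≡
  det-rows≡⇒0 (suc i) zero    i≢j M rows≡ = det-row₀≡⇒0 i M (sym ∘ rows≡)
  det-rows≡⇒0 (suc i) (suc j) i≢j M rows≡ = sumFin-zero λ c → term-minor≡0 M c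
    (det-rows≡⇒0 i j (i≢j ∘ cong suc) (minor M c) λ c′ → rows≡ (punchIn c c′))

  withRow₀ : ∀ {k} → (Fin (suc k) → ℤ) → Matrix (suc k) → Matrix (suc k)
  withRow₀ w M zero    = w
  withRow₀ w M (suc r) = M (suc r)

  det-addRow₀ : ∀ {k} (j : Fin k) (M L : Matrix (suc k)) a →
    (∀ c → L zero c ≡ M zero c + a * M (suc j) c) → (∀ r c → L (suc r) c ≡ M (suc r) c) →
    det L ≡ det M
  det-addRow₀ j M L a L₀ L≗M = begin
    det L                   ≡⟨ det-linear-row₀ M R L 1ℤ a (λ c → trans (L₀ c) (one (M zero c) _)) L≗M L≗M ⟩
    1ℤ * det M + a * det R  ≡⟨ cong (λ z → 1ℤ * det M + a * z) (det-row₀≡⇒0 j R λ _ → refl) ⟩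
    1ℤ * det M + a * 0ℤ     ≡⟨ simplify (det M) a ⟩
    det M ∎
    where
    R = withRow₀ (M (suc j)) M
    one : ∀ x y → x + y ≡ 1ℤ * x + y
    one = solve-∀
    simplify : ∀ x a → 1ℤ * x + a * 0ℤ ≡ x
    simplify = solve-∀

  det-scaleRow₀ : ∀ {k} (M L : Matrix (suc k)) a →
    (∀ c → L zero c ≡ a * M zero c) → (∀ r c → L (suc r) c ≡ M (suc r) c) → det L ≡ a * det M
  det-scaleRow₀ M L a L₀ L≗M =
    trans (det-linear-row₀ M M L a 0ℤ (λ c → trans (L₀ c) (plus0 a (M zero c))) L≗M L≗M) (sym (plus0 a (det M)))
    where plus0 : ∀ a x → a * x ≡ a * x + 0ℤ * x
          plus0 = solve-∀

  det-pivot₀ : ∀ {k} (L : Matrix (suc k)) → (∀ j → L zero (suc j) ≡ 0ℤ) →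
               det L ≡ L zero zero * det (minor L zero)
  det-pivot₀ L L₀ = trans
    (cong (_+_ (1ℤ * (L zero zero * det (minor L zero))))
          (sumFin-zero λ j → term-entry≡0 L (suc j) (L₀ j)))
    (simplify _)
    where simplify : ∀ a → 1ℤ * a + 0ℤ ≡ a
          simplify = solve-∀

  det-pivot₀₁ : ∀ {p} (L : Matrix (suc (suc p))) → (∀ j → L zero (suc (suc j)) ≡ 0ℤ) →
                det L ≡ L zero zero * det (minor L zero) - L zero (suc zero) * det (minor L (suc zero))
  det-pivot₀₁ L L₀ = trans
    (cong (λ z → term L zero + (term L (suc zero) + z))
          (sumFin-zero λ j → term-entry≡0 L (suc (suc j)) (L₀ j)))
    (simplify (L zero zero) (det (minor L zero)) (L zero (suc zero)) (det (minor L (suc zero))))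
    where simplify : ∀ a b c d → 1ℤ * (a * b) + ((-1ℤ * 1ℤ) * (c * d) + 0ℤ) ≡ a * b - c * d
          simplify = solve-∀

  det-diagonal : ∀ {k} d (L : Matrix k) → (∀ r → L r r ≡ d) → (∀ r c → r ≢ c → L r c ≡ 0ℤ) →
                 det L ≡ d Data.Integer.^ k
  det-diagonal {zero}  d L diag off = refl
  det-diagonal {suc k} d L diag off = trans (det-pivot₀ L λ j → off zero (suc j) λ ())
    (cong₂ _*_ (diag zero)
      (det-diagonal d (minor L zero) (diag ∘ suc) λ r c r≢c → off (suc r) (suc c) (r≢c ∘ suc-injective)))

  punchIn-↑ˡ : ∀ {a} b (j : Fin (suc a)) (c : Fin a) → punchIn (j ↑ˡ b) (c ↑ˡ b) ≡ punchIn j c ↑ˡ b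
  punchIn-↑ˡ b zero    c       = refl
  punchIn-↑ˡ b (suc j) zero    = refl
  punchIn-↑ˡ b (suc j) (suc c) = cong suc (punchIn-↑ˡ b j c)

  punchIn-↑ʳ : ∀ a {b} (j : Fin (suc a)) (c : Fin b) → punchIn (j ↑ˡ b) (a ↑ʳ c) ≡ suc (a ↑ʳ c)
  punchIn-↑ʳ a       zero    c = refl
  punchIn-↑ʳ (suc a) (suc j) c = cong suc (punchIn-↑ʳ a j c)

  det-blockLowerTriangular : ∀ a {b} (L : Matrix (a ℕ.+ b)) → (∀ r c → L (r ↑ˡ b) (a ↑ʳ c) ≡ 0ℤ) →
    det L ≡ det (λ r c → L (r ↑ˡ b) (c ↑ˡ b)) * det (λ r c → L (a ↑ʳ r) (a ↑ʳ c))
  det-blockLowerTriangular zero    L upper≡0 = sym (ℤₚ.*-identityˡ _)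
  det-blockLowerTriangular (suc a) {b} L upper≡0 = begin
    det L
      ≡⟨ sumFin-↑ (suc a) (term L) ⟩
    sumFin (λ j → term L (j ↑ˡ b)) + sumFin (λ j → term L (suc a ↑ʳ j))
      ≡⟨ cong₂ _+_ (sumFin-cong left) (sumFin-zero λ j → term-entry≡0 L (suc a ↑ʳ j) (upper≡0 zero j)) ⟩
    sumFin (λ j → det BR * term TL j) + 0ℤ
      ≡⟨ ℤₚ.+-identityʳ _ ⟩
    sumFin (λ j → det BR * term TL j)
      ≡⟨ *-distribˡ-sumFin (det BR) (term TL) ⟩
    det BR * det TL
      ≡⟨ ℤₚ.*-comm (det BR) (det TL) ⟩
    det TL * det BR ∎
    where
    TL : Matrix (suc a)
    TL r c = L (r ↑ˡ b) (c ↑ˡ b)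
    BR : Matrix b
    BR r c = L (suc a ↑ʳ r) (suc a ↑ʳ c)
    rearrange : ∀ s l d e → s * (l * (d * e)) ≡ e * (s * (l * d))
    rearrange = solve-∀
    left : ∀ j → term L (j ↑ˡ b) ≡ det BR * term TL j
    left j = begin
      sign (j ↑ˡ b) * (L zero (j ↑ˡ b) * det (minor L (j ↑ˡ b)))
        ≡⟨ cong₂ (λ s d → s * (L zero (j ↑ˡ b) * d))
             (cong (-1ℤ Data.Integer.^_) (Finₚ.toℕ-↑ˡ j b))
             (det-blockLowerTriangular a (minor L (j ↑ˡ b))
               λ r c → trans (cong (L (suc r ↑ˡ b)) (punchIn-↑ʳ a j c)) (upper≡0 (suc r) c)) ⟩
      sign j * (TL zero j * (det (λ r c → L (suc r ↑ˡ b) (punchIn (j ↑ˡ b) (c ↑ˡ b)))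
                            * det (λ r c → L (suc (a ↑ʳ r)) (punchIn (j ↑ˡ b) (a ↑ʳ c)))))
        ≡⟨ cong₂ (λ d e → sign j * (TL zero j * (d * e)))
             (det-cong λ r c → cong (L (suc r ↑ˡ b)) (punchIn-↑ˡ b j c))
             (det-cong λ r c → cong (L (suc (a ↑ʳ r))) (punchIn-↑ʳ a j c)) ⟩
      sign j * (TL zero j * (det (minor TL j) * det BR))
        ≡⟨ rearrange (sign j) (TL zero j) (det (minor TL j)) (det BR) ⟩
      det BR * term TL j ∎

module CompleteGraph (x : ℤ) where

  open import Data.Nat using (zero; suc)
  open import Data.Fin using (Fin; zero; suc; punchIn)
  open import Data.Fin.Properties using (suc-injective; punchInᵢ≢i)
  open import Data.Integer using (+_; _+_; _-_; _*_; -_; 0ℤ; 1ℤ; -1ℤ; _^_)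
  import Data.Integer.Properties as ℤₚ
  open import Data.Integer.Tactic.RingSolver using (solve-∀)
  open import Data.Product using (_×_; _,_)
  open import Function using (_∘_)
  open import Relation.Binary.PropositionalEquality
  open ≡-Reasoning
  open Determinant

  -- x I - A for the complete graph, and its minor at the entry (0, 1)
  IsCompleteCharMatrix : ∀ {k} → Matrix k → Set
  IsCompleteCharMatrix L = (∀ r → L r r ≡ x) × (∀ r c → r ≢ c → L r c ≡ -1ℤ)

  IsCompleteCharMinor : ∀ {k} → Matrix (suc k) → Set
  IsCompleteCharMinor L =
    (∀ c → L zero c ≡ -1ℤ) × (∀ r → L (suc r) (suc r) ≡ x) × (∀ r c → suc r ≢ c → L (suc r) c ≡ -1ℤ)

  subtractRow₁ : ∀ {k} → Matrix (suc (suc k)) → Matrix (suc (suc k))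
  subtractRow₁ L = withRow₀ (λ c → L zero c + -1ℤ * L (suc zero) c) L

  det-subtractRow₁ : ∀ {k} (L : Matrix (suc (suc k))) → det (subtractRow₁ L) ≡ det L
  det-subtractRow₁ L = det-addRow₀ zero L (subtractRow₁ L) -1ℤ (λ _ → refl) (λ _ _ → refl)

  punchIn₁≢ : ∀ {k} (r : Fin k) c → suc r ≢ c → suc (suc r) ≢ punchIn (suc zero) c
  punchIn₁≢ r zero    r≢c ()
  punchIn₁≢ r (suc c) r≢c eq = r≢c (cong suc (suc-injective (suc-injective eq)))

  det-completeMinor : ∀ k (L : Matrix (suc k)) → IsCompleteCharMinor L → det L ≡ - ((1ℤ + x) ^ k)
  det-completeMinor zero    L (row₀ , _ , _) = cong (λ z → 1ℤ * (z * 1ℤ) + 0ℤ) (row₀ zero)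
  det-completeMinor (suc k) L (row₀ , diag , off) = begin
    det L
      ≡⟨ sym (det-subtractRow₁ L) ⟩
    det L′
      ≡⟨ det-pivot₀₁ L′ (λ j → cong₂ (λ u v → u + -1ℤ * v) (row₀ (suc (suc j))) (off zero (suc (suc j)) λ ())) ⟩
    L′ zero zero * det (minor L′ zero) - L′ zero (suc zero) * det (minor L′ (suc zero))
      ≡⟨ cong₂ (λ u v → u * det (minor L′ zero) - v)
           (cong₂ (λ u v → u + -1ℤ * v) (row₀ zero) (off zero zero λ ()))
           (cong₂ (λ u v → (u + -1ℤ * v) * det (minor L′ (suc zero))) (row₀ (suc zero)) (diag zero)) ⟩
    (-1ℤ + -1ℤ * -1ℤ) * det (minor L′ zero) - (-1ℤ + -1ℤ * x) * det (minor L′ (suc zero))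
      ≡⟨ cong (λ z → (-1ℤ + -1ℤ * -1ℤ) * det (minor L′ zero) - (-1ℤ + -1ℤ * x) * z)
           (det-completeMinor k (minor L′ (suc zero))
             ( (λ c → off zero (punchIn (suc zero) c) (punchInᵢ≢i (suc zero) c ∘ sym))
             , diag ∘ suc
             , λ r c r≢c → off (suc r) (punchIn (suc zero) c) (punchIn₁≢ r c r≢c))) ⟩
    (-1ℤ + -1ℤ * -1ℤ) * det (minor L′ zero) - (-1ℤ + -1ℤ * x) * - ((1ℤ + x) ^ k)
      ≡⟨ simplify x (det (minor L′ zero)) ((1ℤ + x) ^ k) ⟩
    - ((1ℤ + x) ^ suc k) ∎
    where
    L′ = subtractRow₁ L
    simplify : ∀ x D P → (-1ℤ + -1ℤ * -1ℤ) * D - (-1ℤ + -1ℤ * x) * - P ≡ - ((1ℤ + x) * P)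
    simplify = solve-∀

  det-complete : ∀ k (L : Matrix (suc k)) → IsCompleteCharMatrix L →
                 det L ≡ (1ℤ + x) ^ k * ((1ℤ + x) - + suc k)
  det-complete zero    L (diag , _) = trans (cong (λ z → 1ℤ * (z * 1ℤ) + 0ℤ) (diag zero)) (simplify x)
    where simplify : ∀ x → 1ℤ * (x * 1ℤ) + 0ℤ ≡ 1ℤ * ((1ℤ + x) - 1ℤ)
          simplify = solve-∀
  det-complete (suc k) L (diag , off) = begin
    det L
      ≡⟨ sym (det-subtractRow₁ L) ⟩
    det L′
      ≡⟨ det-pivot₀₁ L′ (λ j → cong₂ (λ u v → u + -1ℤ * v) (off zero (suc (suc j)) λ ()) (off (suc zero) (suc (suc j)) λ ())) ⟩
    L′ zero zero * det (minor L′ zero) - L′ zero (suc zero) * det (minor L′ (suc zero))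
      ≡⟨ cong₂ (λ u v → u * det (minor L′ zero) - v)
           (cong₂ (λ u v → u + -1ℤ * v) (diag zero) (off (suc zero) zero λ ()))
           (cong₂ (λ u v → (u + -1ℤ * v) * det (minor L′ (suc zero))) (off zero (suc zero) λ ()) (diag (suc zero))) ⟩
    (x + -1ℤ * -1ℤ) * det (minor L′ zero) - (-1ℤ + -1ℤ * x) * det (minor L′ (suc zero))
      ≡⟨ cong₂ (λ u v → (x + -1ℤ * -1ℤ) * u - (-1ℤ + -1ℤ * x) * v)
           (det-complete k (minor L′ zero) (diag ∘ suc , λ r c r≢c → off (suc r) (suc c) (r≢c ∘ suc-injective)))
           (det-completeMinor k (minor L′ (suc zero))
             ( (λ c → off (suc zero) (punchIn (suc zero) c) (punchInᵢ≢i (suc zero) c ∘ sym))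
             , (λ r → diag (suc (suc r)))
             , λ r c r≢c → off (suc (suc r)) (punchIn (suc zero) c) (punchIn₁≢ r c r≢c))) ⟩
    (x + -1ℤ * -1ℤ) * ((1ℤ + x) ^ k * ((1ℤ + x) - + suc k)) - (-1ℤ + -1ℤ * x) * - ((1ℤ + x) ^ k)
      ≡⟨ simplify x ((1ℤ + x) ^ k) (+ suc k) ⟩
    (1ℤ + x) ^ suc k * ((1ℤ + x) - (1ℤ + + suc k))
      ≡⟨ cong (λ z → (1ℤ + x) ^ suc k * ((1ℤ + x) - z)) (sym (ℤₚ.pos-+ 1 (suc k))) ⟩
    (1ℤ + x) ^ suc k * ((1ℤ + x) - + suc (suc k)) ∎
    where
    L′ = subtractRow₁ L
    simplify : ∀ x P K → (x + -1ℤ * -1ℤ) * (P * ((1ℤ + x) - K)) - (-1ℤ + -1ℤ * x) * - P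
                       ≡ ((1ℤ + x) * P) * ((1ℤ + x) - (1ℤ + K))
    simplify = solve-∀

module PowerGraphMatrix where

  open import Data.Nat as ℕ using (ℕ; zero; suc; _<_; _≤_; _≟_; _<?_; z≤n; s≤s)
  import Data.Nat.Properties as ℕₚ
  open import Data.Fin using (Fin; zero; suc; toℕ; fromℕ<; _↑ˡ_; _↑ʳ_)
  import Data.Fin.Properties as Finₚ
  import Data.Integer as ℤ
  open import Data.Integer using (+_; _+_; _-_; _*_; -_; 0ℤ; 1ℤ; -1ℤ; _^_)
  import Data.Integer.Properties as ℤₚ
  open import Data.Integer.Tactic.RingSolver using (solve-∀)
  open import Data.Product using (_×_; _,_; proj₁; proj₂)
  open import Data.Sum using (_⊎_; inj₁; inj₂)
  open import Function using (_∘_; flip)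
  open import Relation.Binary.PropositionalEquality
  open import Relation.Nullary using (¬_; Dec; yes; no; contradiction)
  open import Relation.Nullary.Decidable using (_⊎-dec_; _×-dec_)
  open ≡-Reasoning
  open Determinant
  open CompleteGraph using (IsCompleteCharMatrix; det-complete)

  -- the edges of the power graph of G(n) for m = 2ⁿ⁻¹, vertices being 0, …, 2m - 1
  Edge : ℕ → ℕ → ℕ → Set
  Edge m a b = a ≡ 0 ⊎ b ≡ 0 ⊎ (a < m × b < m)

  edge? : ∀ m a b → Dec (Edge m a b)
  edge? m a b = (a ≟ 0) ⊎-dec (b ≟ 0) ⊎-dec (a <? m) ×-dec (b <? m)

  ¬Edge : ∀ {m a b} → a ≢ 0 → b ≢ 0 → m ≤ a ⊎ m ≤ b → ¬ Edge m a b
  ¬Edge a≢0 b≢0 m≤a⊎m≤b (inj₁ a≡0)                 = a≢0 a≡0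
  ¬Edge a≢0 b≢0 m≤a⊎m≤b (inj₂ (inj₁ b≡0))          = b≢0 b≡0
  ¬Edge a≢0 b≢0 (inj₁ m≤a) (inj₂ (inj₂ (a<m , _))) = ℕₚ.<⇒≱ a<m m≤a
  ¬Edge a≢0 b≢0 (inj₂ m≤b) (inj₂ (inj₂ (_ , b<m))) = ℕₚ.<⇒≱ b<m m≤b

  charEntry : ℕ → ℤ → ℕ → ℕ → ℤ
  charEntry m x a b with a ≟ b | edge? m a b
  ... | yes _ | _     = x
  ... | no _  | yes _ = -1ℤ
  ... | no _  | no _  = 0ℤ

  charEntry-diag : ∀ m x a → charEntry m x a a ≡ x
  charEntry-diag m x a with a ≟ a | edge? m a a
  ... | yes _   | _ = refl
  ... | no a≢a  | _ = contradiction refl a≢a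

  charEntry-edge : ∀ m x {a b} → a ≢ b → Edge m a b → charEntry m x a b ≡ -1ℤ
  charEntry-edge m x {a} {b} a≢b edge with a ≟ b | edge? m a b
  ... | yes a≡b | _       = contradiction a≡b a≢b
  ... | no _    | yes _   = refl
  ... | no _    | no ¬edge = contradiction edge ¬edge

  charEntry-nonEdge : ∀ m x {a b} → a ≢ b → ¬ Edge m a b → charEntry m x a b ≡ 0ℤ
  charEntry-nonEdge m x {a} {b} a≢b ¬edge with a ≟ b | edge? m a b
  ... | yes a≡b | _      = contradiction a≡b a≢b
  ... | no _    | yes edge = contradiction edge ¬edge
  ... | no _    | no _   = refl

  powerGraphCharPoly : ℕ → ℤ → ℤ
  powerGraphCharPoly m x =
    (x ^ (m ℕ.∸ 1)) * ((1ℤ + x) ^ (m ℕ.∸ 2))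
    * ((x ^ 3) + ((+ 2) - (+ m)) * (x ^ 2) + (1ℤ - (+ (2 ℕ.* m))) * x + ((+ (m ℕ.* m)) - (+ (2 ℕ.* m))))

  module Computation (m₂ : ℕ) (x : ℤ) (M : Matrix (suc (suc m₂) ℕ.+ suc (suc m₂)))
    (M≡ : ∀ r c → M r c ≡ charEntry (suc (suc m₂)) x (toℕ r) (toℕ c)) where

    m₁ m : ℕ
    m₁ = suc m₂
    m  = suc m₁

    e : ℕ → ℕ → ℤ
    e = charEntry m x

    m+s≢0 : ∀ s → m ℕ.+ s ≢ 0
    m+s≢0 s ()

    H-nonEdge : ∀ {s b} → b ≢ 0 → ¬ Edge m (m ℕ.+ s) b
    H-nonEdge b≢0 = ¬Edge (m+s≢0 _) b≢0 (inj₁ (ℕₚ.m≤m+n m _))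

    R : ℕ → ℕ → ℤ
    R zero    b = x * e 0 b
    R (suc t) b = R t b + e (m ℕ.+ t) b

    Mᵗ : ℕ → Matrix (m ℕ.+ m)
    Mᵗ t = withRow₀ (λ c → R t (toℕ c)) M

    det-Mᵗ : ∀ t → t ≤ m → det (Mᵗ t) ≡ x * det M
    det-Mᵗ zero    _   = det-scaleRow₀ M (Mᵗ zero) x (λ c → cong (x *_) (sym (M≡ zero c))) (λ _ _ → refl)
    det-Mᵗ (suc t) t<m = trans (det-addRow₀ j (Mᵗ t) (Mᵗ (suc t)) 1ℤ row₀ (λ _ _ → refl))
                               (det-Mᵗ t (ℕₚ.<⇒≤ t<m))
      where
      j : Fin (m₁ ℕ.+ m)
      j = m₁ ↑ʳ fromℕ< t<m
      toℕ-j : toℕ (suc j) ≡ m ℕ.+ t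
      toℕ-j = cong suc (trans (Finₚ.toℕ-↑ʳ m₁ (fromℕ< t<m)) (cong (m₁ ℕ.+_) (Finₚ.toℕ-fromℕ< t<m)))
      row₀ : ∀ c → R (suc t) (toℕ c) ≡ R t (toℕ c) + 1ℤ * M (suc j) c
      row₀ c = cong (_+_ (R t (toℕ c))) (sym (trans (ℤₚ.*-identityˡ _)
                 (trans (M≡ (suc j) c) (cong (λ a → e a (toℕ c)) toℕ-j))))

    R-zero : ∀ t → R t 0 ≡ x * x - + t
    R-zero zero    = trans (cong (x *_) (charEntry-diag m x 0)) (sym (ℤₚ.+-identityʳ (x * x)))
    R-zero (suc t) = begin
      R t 0 + e (m ℕ.+ t) 0 ≡⟨ cong₂ _+_ (R-zero t) (charEntry-edge m x (m+s≢0 t) (inj₂ (inj₁ refl))) ⟩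
      x * x - + t + -1ℤ     ≡⟨ simplify x (+ t) ⟩
      x * x - (1ℤ + + t)    ≡⟨ cong (λ z → x * x - z) (sym (ℤₚ.pos-+ 1 t)) ⟩
      x * x - + suc t ∎
      where simplify : ∀ x t → x * x - t + -1ℤ ≡ x * x - (1ℤ + t)
            simplify = solve-∀

    R-P : ∀ t b → 0 < b → b < m → R t b ≡ x * -1ℤ
    R-P zero    (suc b) _   _   = cong (x *_) (charEntry-edge m x {b = suc b} (λ ()) (inj₁ refl))
    R-P (suc t) b       0<b b<m = trans
      (cong₂ _+_ (R-P t b 0<b b<m)
        (charEntry-nonEdge m x (ℕₚ.>⇒≢ (ℕₚ.<-≤-trans b<m (ℕₚ.m≤m+n m t))) (H-nonEdge (ℕₚ.>⇒≢ 0<b))))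
      (ℤₚ.+-identityʳ _)

    R-H-before : ∀ t s → t ≤ s → R t (m ℕ.+ s) ≡ x * -1ℤ
    R-H-before zero    s _   = cong (x *_) (charEntry-edge m x (m+s≢0 s ∘ sym) (inj₁ refl))
    R-H-before (suc t) s t<s = trans
      (cong₂ _+_ (R-H-before t s (ℕₚ.<⇒≤ t<s))
        (charEntry-nonEdge m x (ℕₚ.<⇒≢ (ℕₚ.+-monoʳ-< m t<s)) (H-nonEdge (m+s≢0 s))))
      (ℤₚ.+-identityʳ _)

    R-H-after : ∀ d s → R (suc (d ℕ.+ s)) (m ℕ.+ s) ≡ x * -1ℤ + x
    R-H-after zero    s = cong₂ _+_ (R-H-before s s ℕₚ.≤-refl) (charEntry-diag m x (m ℕ.+ s))
    R-H-after (suc d) s = trans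
      (cong₂ _+_ (R-H-after d s)
        (charEntry-nonEdge m x (ℕₚ.>⇒≢ (ℕₚ.+-monoʳ-< m (s≤s (ℕₚ.m≤n+m s d)))) (H-nonEdge (m+s≢0 s))))
      (ℤₚ.+-identityʳ _)

    R-H : ∀ s → s < m → R m (m ℕ.+ s) ≡ 0ℤ
    R-H s s<m = begin
      R m (m ℕ.+ s)                          ≡⟨ cong (λ t → R t (m ℕ.+ s)) (sym m≡) ⟩
      R (suc ((m ℕ.∸ suc s) ℕ.+ s)) (m ℕ.+ s) ≡⟨ R-H-after (m ℕ.∸ suc s) s ⟩
      x * -1ℤ + x                            ≡⟨ cancel x ⟩
      0ℤ ∎
      where
      m≡ : suc ((m ℕ.∸ suc s) ℕ.+ s) ≡ m
      m≡ = trans (sym (ℕₚ.+-suc (m ℕ.∸ suc s) s)) (ℕₚ.m∸n+n≡m s<m)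
      cancel : ∀ x → x * -1ℤ + x ≡ 0ℤ
      cancel = solve-∀

    upperRight≡0 : ∀ (r c : Fin m) → Mᵗ m (r ↑ˡ m) (m ↑ʳ c) ≡ 0ℤ
    upperRight≡0 zero    c = trans (cong (R m) (Finₚ.toℕ-↑ʳ m c)) (R-H (toℕ c) (Finₚ.toℕ<n c))
    upperRight≡0 (suc r) c = trans (M≡ (suc r ↑ˡ m) (m ↑ʳ c)) (charEntry-nonEdge m x a≢b
      (¬Edge (λ ()) (m+s≢0 _ ∘ trans (sym (Finₚ.toℕ-↑ʳ m c))) (inj₂ m≤b)))
      where
      m≤b : m ≤ toℕ (m ↑ʳ c)
      m≤b = ℕₚ.≤-trans (ℕₚ.m≤m+n m (toℕ c)) (ℕₚ.≤-reflexive (sym (Finₚ.toℕ-↑ʳ m c)))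
      a≢b : toℕ (suc r ↑ˡ m) ≢ toℕ (m ↑ʳ c)
      a≢b = ℕₚ.<⇒≢ (ℕₚ.<-≤-trans (subst (_< m) (sym (Finₚ.toℕ-↑ˡ (suc r) m)) (Finₚ.toℕ<n (suc r))) m≤b)

    det-lowerRight : det (λ r c → Mᵗ m (m ↑ʳ r) (m ↑ʳ c)) ≡ x ^ m
    det-lowerRight = det-diagonal x _
      (λ r → trans (M≡ (m ↑ʳ r) (m ↑ʳ r)) (charEntry-diag m x _))
      (λ r c r≢c → trans (M≡ (m ↑ʳ r) (m ↑ʳ c)) (begin
        e (toℕ (m ↑ʳ r)) (toℕ (m ↑ʳ c)) ≡⟨ cong₂ e (Finₚ.toℕ-↑ʳ m r) (Finₚ.toℕ-↑ʳ m c) ⟩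
        e (m ℕ.+ toℕ r) (m ℕ.+ toℕ c)   ≡⟨ charEntry-nonEdge m x
                                            (r≢c ∘ Finₚ.toℕ-injective ∘ ℕₚ.+-cancelˡ-≡ m _ _)
                                            (H-nonEdge (m+s≢0 _)) ⟩
        0ℤ ∎))

    C : Matrix m
    C r c = e (toℕ r) (toℕ c)

    C-complete : IsCompleteCharMatrix x C
    C-complete = (λ r → charEntry-diag m x (toℕ r))
               , λ r c r≢c → charEntry-edge m x (r≢c ∘ Finₚ.toℕ-injective)
                               (inj₂ (inj₂ (Finₚ.toℕ<n r , Finₚ.toℕ<n c)))

    e₀ : Fin m → ℤ
    e₀ zero    = 1ℤ
    e₀ (suc _) = 0ℤ

    TL : Matrix m
    TL r c = Mᵗ m (r ↑ˡ m) (c ↑ˡ m)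

    det-upperLeft : det TL ≡ x * det C + (- + m) * det (withRow₀ e₀ C)
    det-upperLeft = det-linear-row₀ C (withRow₀ e₀ C) TL x (- + m) row₀ rows rows
      where
      rows : ∀ r c → TL (suc r) c ≡ C (suc r) c
      rows r c = trans (M≡ (suc r ↑ˡ m) (c ↑ˡ m)) (cong₂ e (Finₚ.toℕ-↑ˡ (suc r) m) (Finₚ.toℕ-↑ˡ c m))
      row₀ : ∀ c → TL zero c ≡ x * C zero c + (- + m) * e₀ c
      row₀ zero    = trans (R-zero m) (trans (simplify x (+ m)) (cong (λ z → x * z + (- + m) * 1ℤ)
                       (sym (charEntry-diag m x 0))))
        where simplify : ∀ x M → x * x - M ≡ x * x + (- M) * 1ℤ
              simplify = solve-∀
      row₀ (suc c) = trans (R-P m _ (s≤s z≤n) (subst (_< m) (sym (Finₚ.toℕ-↑ˡ (suc c) m)) (Finₚ.toℕ<n (suc c))))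
                       (trans (simplify x (+ m)) (cong (λ z → x * z + (- + m) * 0ℤ)
                         (sym (charEntry-edge m x {b = suc (toℕ c)} (λ ()) (inj₁ refl)))))
        where simplify : ∀ x M → x * -1ℤ ≡ x * -1ℤ + (- M) * 0ℤ
              simplify = solve-∀

    x*detM≡ : x * det M ≡ det TL * x ^ m
    x*detM≡ = begin
      x * det M                                                 ≡⟨ sym (det-Mᵗ m ℕₚ.≤-refl) ⟩
      det (Mᵗ m)                                                ≡⟨ det-blockLowerTriangular m (Mᵗ m) upperRight≡0 ⟩
      det TL * det (λ r c → Mᵗ m (m ↑ʳ r) (m ↑ʳ c))             ≡⟨ cong (det TL *_) det-lowerRight ⟩
      det TL * x ^ m ∎

    det-C : det C ≡ (1ℤ + x) ^ m₁ * ((1ℤ + x) - + m)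
    det-C = det-complete x m₁ C C-complete

    det-withRow₀-e₀ : det (withRow₀ e₀ C) ≡ 1ℤ * ((1ℤ + x) ^ m₂ * ((1ℤ + x) - + m₁))
    det-withRow₀-e₀ = trans (det-pivot₀ (withRow₀ e₀ C) λ _ → refl) (cong (1ℤ *_)
      (det-complete x m₂ (minor (withRow₀ e₀ C) zero)
        ( (λ r → proj₁ C-complete (suc r))
        , λ r c r≢c → proj₂ C-complete (suc r) (suc c) (r≢c ∘ Finₚ.suc-injective))))

    -- powers of x are spelled out because the ring solver does not handle _^_
    charPoly-identity : ∀ x P Q M₁ →
      (x * ((1ℤ + x) * P * ((1ℤ + x) - (1ℤ + M₁))) + (- (1ℤ + M₁)) * (1ℤ * (P * ((1ℤ + x) - M₁)))) * Q
      ≡ Q * P * (x * (x * (x * 1ℤ)) + ((1ℤ + 1ℤ) - (1ℤ + M₁)) * (x * (x * 1ℤ)) + (1ℤ - ((1ℤ + M₁) + (1ℤ + M₁))) * x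
                 + ((1ℤ + M₁) * (1ℤ + M₁) - ((1ℤ + M₁) + (1ℤ + M₁))))
    charPoly-identity = solve-∀

    det-M-nonzero : x ≢ 0ℤ → det M ≡ powerGraphCharPoly m x
    det-M-nonzero x≢0 = begin
      det M
        ≡⟨ ℤₚ.*-cancelˡ-≡ x (det M) (det TL * x ^ m₁) {{ℤ.≢-nonZero x≢0}}
             (trans x*detM≡ (swap (det TL) x (x ^ m₁))) ⟩
      det TL * x ^ m₁
        ≡⟨ cong (_* x ^ m₁) (trans det-upperLeft (cong₂ (λ u v → x * u + (- + m) * v) det-C det-withRow₀-e₀)) ⟩
      (x * ((1ℤ + x) ^ m₁ * ((1ℤ + x) - + m)) + (- + m) * (1ℤ * ((1ℤ + x) ^ m₂ * ((1ℤ + x) - + m₁)))) * x ^ m₁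
        ≡⟨ charPoly-identity x ((1ℤ + x) ^ m₂) (x ^ m₁) (+ m₁) ⟩
      target (+ m + + m) (+ m * + m)
        ≡⟨ cong₂ target (cong +_ (sym (cong (m ℕ.+_) (ℕₚ.+-identityʳ m)))) (sym (ℤₚ.pos-* m m)) ⟩
      powerGraphCharPoly m x ∎
      where
      swap : ∀ a x q → a * (x * q) ≡ x * (a * q)
      swap = solve-∀
      target : ℤ → ℤ → ℤ
      target 2m m² = x ^ m₁ * (1ℤ + x) ^ m₂ * ((x ^ 3) + ((+ 2) - (+ m)) * (x ^ 2) + (1ℤ - 2m) * x + (m² - 2m))

    H-rows≡ : x ≡ 0ℤ → ∀ s s′ b → e (m ℕ.+ s) b ≡ e (m ℕ.+ s′) b
    H-rows≡ x≡0 s s′ b = byZero (b ≟ 0)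
      where
      entry : ∀ s → b ≢ 0 → Dec (m ℕ.+ s ≡ b) → e (m ℕ.+ s) b ≡ 0ℤ
      entry s b≢0 (yes a≡b) = trans (cong (e (m ℕ.+ s)) (sym a≡b)) (trans (charEntry-diag m x (m ℕ.+ s)) x≡0)
      entry s b≢0 (no a≢b)  = charEntry-nonEdge m x a≢b (H-nonEdge b≢0)
      byZero : Dec (b ≡ 0) → e (m ℕ.+ s) b ≡ e (m ℕ.+ s′) b
      byZero (yes b≡0) = trans (charEntry-edge m x (m+s≢0 s ∘ flip trans b≡0) (inj₂ (inj₁ b≡0)))
                               (sym (charEntry-edge m x (m+s≢0 s′ ∘ flip trans b≡0) (inj₂ (inj₁ b≡0))))
      byZero (no b≢0)  = trans (entry s b≢0 (m ℕ.+ s ≟ b)) (sym (entry s′ b≢0 (m ℕ.+ s′ ≟ b)))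

    det-M-zero : x ≡ 0ℤ → det M ≡ powerGraphCharPoly m x
    det-M-zero x≡0 = trans (det-rows≡⇒0 (m ↑ʳ zero) (m ↑ʳ suc zero) i≢j M rows≡) (cong (powerGraphCharPoly m) (sym x≡0))
      where
      i≢j : m ↑ʳ zero ≢ m ↑ʳ suc zero
      i≢j eq = ℕₚ.m≢1+m+n m {0} (trans (sym (ℕₚ.+-identityʳ m)) (trans (sym (Finₚ.toℕ-↑ʳ m zero))
                 (trans (cong toℕ eq) (trans (Finₚ.toℕ-↑ʳ m (suc zero)) (ℕₚ.+-suc m 0)))))
      rows≡ : ∀ c → M (m ↑ʳ suc zero) c ≡ M (m ↑ʳ zero) c
      rows≡ c = begin
        M (m ↑ʳ suc zero) c              ≡⟨ M≡ _ c ⟩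
        e (toℕ (m ↑ʳ suc zero)) (toℕ c)  ≡⟨ cong (λ a → e a (toℕ c)) (Finₚ.toℕ-↑ʳ m (suc zero)) ⟩
        e (m ℕ.+ 1) (toℕ c)              ≡⟨ H-rows≡ x≡0 1 0 (toℕ c) ⟩
        e (m ℕ.+ 0) (toℕ c)              ≡⟨ cong (λ a → e a (toℕ c)) (sym (Finₚ.toℕ-↑ʳ m zero)) ⟩
        e (toℕ (m ↑ʳ zero)) (toℕ c)      ≡⟨ sym (M≡ _ c) ⟩
        M (m ↑ʳ zero) c ∎

  det-charEntry : ∀ m x → 2 ≤ m → ∀ {K} → K ≡ m ℕ.+ m → (M : Matrix K) →
                  (∀ r c → M r c ≡ charEntry m x (toℕ r) (toℕ c)) → det M ≡ powerGraphCharPoly m x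
  det-charEntry (suc (suc m₂)) x (s≤s (s≤s z≤n)) refl M M≡ with x ℤ.≟ 0ℤ
  ... | yes x≡0 = Computation.det-M-zero m₂ x M M≡ x≡0
  ... | no x≢0  = Computation.det-M-nonzero m₂ x M M≡ x≢0

module CyclicTwoGroup where

  open import Data.Nat
  open import Data.Nat.Properties
  open import Data.Nat.DivMod
  open import Data.Nat.Divisibility
  open import Data.Nat.Coprimality using (Coprime; coprime-Bézout; coprime-divisor)
  open import Data.Nat.GCD using (module Bézout)
  open import Data.Nat.Tactic.RingSolver using (solve-∀)
  open import Data.Product using (∃; _,_; proj₁; proj₂)
  open import Data.Sum using (_⊎_; inj₁; inj₂)
  open import Data.Empty using (⊥-elim)
  open import Relation.Binary.PropositionalEquality
  open import Relation.Nullary using (¬_; yes; no)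
  open import Function using (_∘′_; flip)
  open ≡-Reasoning

  _mod2^_ : ℕ → ℕ → ℕ
  a mod2^ e = _%_ a (2 ^ e) {{m^n≢0 2 e}}

  Multiple : ℕ → ℕ → ℕ → Set
  Multiple e a b = ∃ λ k → (suc k * a) mod2^ e ≡ b

  coprime⇒multiple : ∀ n a b → Coprime a (suc n) → ∃ λ t → (t * a) % suc n ≡ b % suc n
  coprime⇒multiple n a b coprime with coprime-Bézout coprime
  ... | Bézout.+- x y eq = x * b , (begin
    (x * b * a) % suc n              ≡⟨ cong (_% suc n) (trans (regroup x b a) (cong (b *_) (sym eq))) ⟩
    (b * (1 + y * suc n)) % suc n    ≡⟨ cong (_% suc n) (expand b y n) ⟩
    (b + (b * y) * suc n) % suc n    ≡⟨ [m+kn]%n≡m%n b (b * y) (suc n) ⟩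
    b % suc n ∎)
    where
    regroup : ∀ x b a → x * b * a ≡ b * (x * a)
    regroup = solve-∀
    expand : ∀ b y n → b * (1 + y * (1 + n)) ≡ b + (b * y) * (1 + n)
    expand = solve-∀
  ... | Bézout.-+ x y eq = b * n * x , (begin
    (b * n * x * a) % suc n                   ≡⟨ sym ([m+kn]%n≡m%n (b * n * x * a) b (suc n)) ⟩
    (b * n * x * a + b * suc n) % suc n       ≡⟨ cong (_% suc n) (trans (regroup b n x a) (cong (λ z → b + b * n * z) eq)) ⟩
    (b + b * n * (y * suc n)) % suc n         ≡⟨ cong (_% suc n) (reassoc b n y) ⟩
    (b + (b * n * y) * suc n) % suc n         ≡⟨ [m+kn]%n≡m%n b (b * n * y) (suc n) ⟩
    b % suc n ∎)
    where
    regroup : ∀ b n x a → b * n * x * a + b * (1 + n) ≡ b + b * n * (1 + x * a)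
    regroup = solve-∀
    reassoc : ∀ b n y → b + b * n * (y * (1 + n)) ≡ b + (b * n * y) * (1 + n)
    reassoc = solve-∀

  odd⇒coprime-2 : ∀ a → ¬ 2 ∣ a → Coprime a 2
  odd⇒coprime-2 a 2∤a {zero}                (_ , 0∣2) with () ← 0∣⇒≡0 0∣2
  odd⇒coprime-2 a 2∤a {suc zero}            _         = refl
  odd⇒coprime-2 a 2∤a {suc (suc zero)}      (2∣a , _) = ⊥-elim (2∤a 2∣a)
  odd⇒coprime-2 a 2∤a {suc (suc (suc d))}   (_ , d∣2) with ∣⇒≤ d∣2
  ... | s≤s (s≤s ())

  odd⇒coprime-2^ : ∀ e a → ¬ 2 ∣ a → Coprime a (2 ^ e)
  odd⇒coprime-2^ zero    a 2∤a (_ , d∣1)   = ∣1⇒≡1 d∣1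
  odd⇒coprime-2^ (suc e) a 2∤a {d} (d∣a , d∣2^e⁺) =
    odd⇒coprime-2^ e a 2∤a (d∣a , coprime-divisor (odd⇒coprime-2 d (2∤a ∘′ flip ∣-trans d∣a)) d∣2^e⁺)

  odd⇒generates : ∀ e a b → ¬ 2 ∣ a → b < 2 ^ e → ∃ λ t → (t * a) mod2^ e ≡ b
  odd⇒generates e a b 2∤a b<2^e = t , (begin
    (t * a) mod2^ e ≡⟨ %-congʳ (sym 2^e≡) ⟩
    (t * a) % suc n ≡⟨ t*a≡b ⟩
    b % suc n       ≡⟨ m<n⇒m%n≡m (subst (b <_) (sym 2^e≡) b<2^e) ⟩
    b ∎)
    where
    instance _ = m^n≢0 2 e
    n = pred (2 ^ e)
    2^e≡ : suc n ≡ 2 ^ e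
    2^e≡ = suc-pred (2 ^ e)
    generated = coprime⇒multiple n a b (subst (Coprime a) (sym 2^e≡) (odd⇒coprime-2^ e a 2∤a))
    t = proj₁ generated
    t*a≡b = proj₂ generated

  double-mod2^ : ∀ e t a b → (t * a) mod2^ e ≡ b → (t * (a * 2)) mod2^ suc e ≡ b * 2
  double-mod2^ e t a b t*a≡b = begin
    (t * (a * 2)) mod2^ suc e    ≡⟨ cong (_mod2^ suc e) (sym (*-assoc t a 2)) ⟩
    (t * a * 2) mod2^ suc e      ≡⟨ %-congʳ (*-comm 2 (2 ^ e)) ⟩
    (t * a * 2) % (2 ^ e * 2)    ≡⟨ sym (m%n*o≡m*o%[n*o] (t * a) (2 ^ e) 2) ⟩
    (t * a) mod2^ e * 2          ≡⟨ cong (_* 2) t*a≡b ⟩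
    b * 2 ∎
    where instance _ = m^n≢0 2 e
                   _ = m*n≢0 (2 ^ e) 2
                   _ = m^n≢0 2 (suc e)

  half<2^ : ∀ e c → c * 2 < 2 ^ suc e → c < 2 ^ e
  half<2^ e c c*2< = *-cancelˡ-< 2 c (2 ^ e) (subst (_< 2 * 2 ^ e) (*-comm c 2) c*2<)

  -- Either a or b is odd, hence a unit; otherwise halve both and recurse.
  multiple⊎multiple₀ : ∀ e a b → a < 2 ^ e → b < 2 ^ e →
    (∃ λ t → (t * a) mod2^ e ≡ b) ⊎ (∃ λ t → (t * b) mod2^ e ≡ a)
  multiple⊎multiple₀ zero    zero    zero    _         _         = inj₁ (0 , refl)
  multiple⊎multiple₀ zero    (suc a) _       (s≤s ())  _
  multiple⊎multiple₀ zero    zero    (suc b) _         (s≤s ())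
  multiple⊎multiple₀ (suc e) a       b       a<2^e b<2^e with 2 ∣? a | 2 ∣? b
  ... | no 2∤a | _      = inj₁ (odd⇒generates (suc e) a b 2∤a b<2^e)
  ... | yes _  | no 2∤b = inj₂ (odd⇒generates (suc e) b a 2∤b a<2^e)
  ... | yes (divides a′ refl) | yes (divides b′ refl)
    with multiple⊎multiple₀ e a′ b′ (half<2^ e a′ a<2^e) (half<2^ e b′ b<2^e)
  ...   | inj₁ (t , t*a′≡b′) = inj₁ (t , double-mod2^ e t a′ b′ t*a′≡b′)
  ...   | inj₂ (t , t*b′≡a′) = inj₂ (t , double-mod2^ e t b′ a′ t*b′≡a′)

  multiple-positive : ∀ e t a b → (t * a) mod2^ e ≡ b → Multiple e a b
  multiple-positive e t a b t*a≡b = t + n , (begin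
    (suc (t + n) * a) mod2^ e     ≡⟨ cong (_mod2^ e) (expand t n a) ⟩
    (t * a + a * suc n) mod2^ e   ≡⟨ cong (λ z → (t * a + a * z) mod2^ e) 2^e≡ ⟩
    (t * a + a * 2 ^ e) mod2^ e   ≡⟨ [m+kn]%n≡m%n (t * a) a (2 ^ e) ⟩
    (t * a) mod2^ e               ≡⟨ t*a≡b ⟩
    b ∎)
    where
    instance _ = m^n≢0 2 e
    n = pred (2 ^ e)
    2^e≡ : suc n ≡ 2 ^ e
    2^e≡ = suc-pred (2 ^ e)
    expand : ∀ t n a → (1 + (t + n)) * a ≡ t * a + a * (1 + n)
    expand = solve-∀

  multiple⊎multiple : ∀ e a b → a < 2 ^ e → b < 2 ^ e → Multiple e a b ⊎ Multiple e b a
  multiple⊎multiple e a b a<2^e b<2^e with multiple⊎multiple₀ e a b a<2^e b<2^e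
  ... | inj₁ (t , t*a≡b) = inj₁ (multiple-positive e t a b t*a≡b)
  ... | inj₂ (t , t*b≡a) = inj₂ (multiple-positive e t b a t*b≡a)

module PowerGraph (k : ℕ) where

  open import Data.Nat
  open import Data.Nat.Properties
  open import Data.Nat.DivMod
  open import Data.Nat.Tactic.RingSolver using (solve-∀)
  open import Data.Bool using (true; false)
  open import Data.Bool.Properties using (T-≡)
  open import Data.Fin as Fin using (Fin; toℕ)
  import Data.Fin.Properties as Finₚ
  open import Data.Integer as ℤ using (ℤ)
  import Data.Integer.Properties as ℤₚ
  open import Data.Product using (∃; _,_; proj₁; proj₂)
  open import Data.Sum using (_⊎_; inj₁; inj₂; [_,_]; swap)
  open import Function using (_∘_; Equivalence)
  open import Relation.Binary.PropositionalEquality hiding ([_])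
  open import Relation.Nullary using (¬_; Dec; yes; no; contradiction)
  open ≡-Reasoning
  open CyclicTwoGroup using (_mod2^_; multiple⊎multiple)
  open PowerGraphMatrix using (Edge; edge?; charEntry; charEntry-diag; charEntry-edge; charEntry-nonEdge)

  n e m : ℕ
  n = suc (suc k)
  e = suc k
  m = 2 ^ e

  private instance
    m≢0 : NonZero m
    m≢0 = m^n≢0 2 e

  <⇒<ᵇ≡true : ∀ {a b} → a < b → (a <ᵇ b) ≡ true
  <⇒<ᵇ≡true = Equivalence.to T-≡ ∘ <⇒<ᵇ

  ≥⇒<ᵇ≡false : ∀ {a b} → b ≤ a → (a <ᵇ b) ≡ false
  ≥⇒<ᵇ≡false {a} {b} b≤a with a <ᵇ b in a<ᵇb
  ... | true  = contradiction (<ᵇ⇒< a b (Equivalence.from T-≡ a<ᵇb)) (≤⇒≯ b≤a)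
  ... | false = refl

  oplus-PP : ∀ {i j} → i < m → j < m → oplus n i j ≡ (i + j) mod2^ e
  oplus-PP i<m j<m rewrite <⇒<ᵇ≡true i<m | <⇒<ᵇ≡true j<m = refl

  oplus-HP : ∀ {i j} → m ≤ i → j < m → oplus n i j ≡ (i + (half n / 2 ∸ 1) * j) mod2^ e + m
  oplus-HP m≤i j<m rewrite ≥⇒<ᵇ≡false m≤i | <⇒<ᵇ≡true j<m = refl

  oplus-HH : ∀ {i j} → m ≤ i → m ≤ j →
             oplus n i j ≡ ((half n / 2 + 1) * i + (half n / 2 ∸ 1) * j) mod2^ e
  oplus-HH m≤i m≤j rewrite ≥⇒<ᵇ≡false m≤i | ≥⇒<ᵇ≡false m≤j = refl

  mod-absorbʳ : ∀ a b → (a + b mod2^ e) mod2^ e ≡ (a + b) mod2^ e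
  mod-absorbʳ a b = begin
    (a + b % m) % m           ≡⟨ %-distribˡ-+ a (b % m) m ⟩
    (a % m + b % m % m) % m   ≡⟨ cong (λ z → (a % m + z) % m) (m%n%n≡m%n b m) ⟩
    (a % m + b % m) % m       ≡⟨ sym (%-distribˡ-+ a b m) ⟩
    (a + b) % m ∎

  gpow-P : ∀ {a} i → a < m → gpow n a i ≡ (suc i * a) mod2^ e
  gpow-P {a} zero    a<m = sym (trans (cong (_mod2^ e) (+-identityʳ a)) (m<n⇒m%n≡m a<m))
  gpow-P {a} (suc i) a<m = begin
    oplus n a (gpow n a i)              ≡⟨ cong (oplus n a) (gpow-P i a<m) ⟩
    oplus n a ((suc i * a) mod2^ e)     ≡⟨ oplus-PP a<m (m%n<n (suc i * a) m) ⟩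
    (a + (suc i * a) mod2^ e) mod2^ e   ≡⟨ mod-absorbʳ a (suc i * a) ⟩
    (suc (suc i) * a) mod2^ e ∎

  gpow-P<m : ∀ {a} i → a < m → gpow n a i < m
  gpow-P<m {a} i a<m = subst (_< m) (sym (gpow-P i a<m)) (m%n<n (suc i * a) m)

  -- (m/2 + 1) a + (m/2 - 1) a = m a
  H-order2 : ∀ {a} → m ≤ a → oplus n a a ≡ 0
  H-order2 {a} m≤a = begin
    oplus n a a                                            ≡⟨ oplus-HH m≤a m≤a ⟩
    ((half n / 2 + 1) * a + (half n / 2 ∸ 1) * a) mod2^ e  ≡⟨ cong (λ h → ((h + 1) * a + (h ∸ 1) * a) mod2^ e) m/2≡ ⟩
    ((suc p + 1) * a + p * a) mod2^ e                      ≡⟨ cong (_mod2^ e) (regroup p a) ⟩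
    (a * (2 * suc p)) mod2^ e                              ≡⟨ cong (λ z → (a * (2 * z)) mod2^ e) 2^k≡ ⟩
    (a * m) mod2^ e                                        ≡⟨ m*n%n≡0 a m ⟩
    0 ∎
    where
    p = pred (2 ^ k)
    2^k≡ : suc p ≡ 2 ^ k
    2^k≡ = suc-pred (2 ^ k) {{m^n≢0 2 k}}
    m/2≡ : half n / 2 ≡ suc p
    m/2≡ = trans (cong (_/ 2) (*-comm 2 (2 ^ k))) (trans (m*n/n≡m (2 ^ k) 2) (sym 2^k≡))
    regroup : ∀ p a → ((1 + p) + 1) * a + p * a ≡ a * (2 * (1 + p))
    regroup = solve-∀

  H-identityʳ : ∀ {a} → m ≤ a → a < m + m → oplus n a 0 ≡ a
  H-identityʳ {a} m≤a a<2m = begin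
    oplus n a 0                                  ≡⟨ oplus-HP m≤a (m^n>0 2 e) ⟩
    (a + (half n / 2 ∸ 1) * 0) mod2^ e + m       ≡⟨ cong (λ z → (a + z) mod2^ e + m) (*-zeroʳ (half n / 2 ∸ 1)) ⟩
    (a + 0) mod2^ e + m                          ≡⟨ cong (λ z → z mod2^ e + m) (trans (+-identityʳ a) (sym (m∸n+n≡m m≤a))) ⟩
    ((a ∸ m) + m) mod2^ e + m                    ≡⟨ cong (_+ m) ([m+n]%n≡m%n (a ∸ m) m) ⟩
    (a ∸ m) mod2^ e + m                          ≡⟨ cong (_+ m) (m<n⇒m%n≡m a∸m<m) ⟩
    (a ∸ m) + m                                  ≡⟨ m∸n+n≡m m≤a ⟩
    a ∎
    where a∸m<m : a ∸ m < m
          a∸m<m = +-cancelˡ-< m (a ∸ m) m (subst (_< m + m) (sym (m+[n∸m]≡n m≤a)) a<2m)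

  gpow-H : ∀ {a} i → m ≤ a → a < m + m → gpow n a i ≡ a ⊎ gpow n a i ≡ 0
  gpow-H zero    m≤a a<2m = inj₁ refl
  gpow-H {a} (suc i) m≤a a<2m with gpow-H i m≤a a<2m
  ... | inj₁ aⁱ≡a = inj₂ (trans (cong (oplus n a) aⁱ≡a) (H-order2 m≤a))
  ... | inj₂ aⁱ≡0 = inj₁ (trans (cong (oplus n a) aⁱ≡0) (H-identityʳ m≤a a<2m))

  Related : ℕ → ℕ → Set
  Related a b = (∃ λ i → gpow n a i ≡ b) ⊎ (∃ λ i → gpow n b i ≡ a)

  P-related : ∀ {a b} → a < m → b < m → Related a b
  P-related {a} {b} a<m b<m with multiple⊎multiple e a b a<m b<m
  ... | inj₁ (i , iab) = inj₁ (i , trans (gpow-P i a<m) iab)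
  ... | inj₂ (i , iba) = inj₂ (i , trans (gpow-P i b<m) iba)

  H-reaches-0 : ∀ {a} → m ≤ a → ∃ λ i → gpow n a i ≡ 0
  H-reaches-0 m≤a = 1 , H-order2 m≤a

  edge⇒related : ∀ {a b} → a < m + m → b < m + m → Edge m a b → Related a b
  edge⇒related {a} {b} _ b<2m (inj₁ refl) with b <? m
  ... | yes b<m = P-related (m^n>0 2 e) b<m
  ... | no b≮m  = inj₂ (H-reaches-0 (≮⇒≥ b≮m))
  edge⇒related {a} {b} a<2m _ (inj₂ (inj₁ refl)) with a <? m
  ... | yes a<m = P-related a<m (m^n>0 2 e)
  ... | no a≮m  = inj₁ (H-reaches-0 (≮⇒≥ a≮m))
  edge⇒related _ _ (inj₂ (inj₂ (a<m , b<m))) = P-related a<m b<m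

  -- the powers of an element of H are itself and 0, those of an element of P stay in P
  ¬reaches : ∀ {a b} → a < m + m → a ≢ b → b ≢ 0 → m ≤ a ⊎ m ≤ b → ¬ (∃ λ i → gpow n a i ≡ b)
  ¬reaches {a} {b} a<2m a≢b b≢0 m≤a⊎m≤b (i , aⁱ≡b) with a <? m
  ... | no a≮m = [ (λ aⁱ≡a → a≢b (trans (sym aⁱ≡a) aⁱ≡b)) , (λ aⁱ≡0 → b≢0 (trans (sym aⁱ≡b) aⁱ≡0)) ]
                   (gpow-H i (≮⇒≥ a≮m) a<2m)
  ... | yes a<m = [ <⇒≱ a<m , <⇒≱ (subst (_< m) aⁱ≡b (gpow-P<m i a<m)) ] m≤a⊎m≤b

  ¬edge⇒¬related : ∀ {a b} → a < m + m → b < m + m → a ≢ b → ¬ Edge m a b → ¬ Related a b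
  ¬edge⇒¬related {a} {b} a<2m b<2m a≢b ¬edge =
    [ ¬reaches a<2m a≢b b≢0 m≤a⊎m≤b , ¬reaches b<2m (a≢b ∘ sym) a≢0 (swap m≤a⊎m≤b) ]
    where
    a≢0 : a ≢ 0
    a≢0 = ¬edge ∘ inj₁
    b≢0 : b ≢ 0
    b≢0 = ¬edge ∘ inj₂ ∘ inj₁
    m≤a⊎m≤b : m ≤ a ⊎ m ≤ b
    m≤a⊎m≤b with a <? m | b <? m
    ... | yes a<m | yes b<m = contradiction (inj₂ (inj₂ (a<m , b<m))) ¬edge
    ... | no a≮m  | _       = inj₁ (≮⇒≥ a≮m)
    ... | yes _   | no b≮m  = inj₂ (≮⇒≥ b≮m)

  toℕ<m+m : (u : Fin (2 ^ n)) → toℕ u < m + m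
  toℕ<m+m u = subst (λ z → toℕ u < m + z) (+-identityʳ m) (Finₚ.toℕ<n u)

  charMat≡charEntry : ∀ x (A : Fin (2 ^ n) → Fin (2 ^ n) → ℤ) → IsAdjMatrix n A →
                      ∀ u v → charMat x A u v ≡ charEntry m x (toℕ u) (toℕ v)
  charMat≡charEntry x A adj u v with u Fin.≟ v
  ... | yes refl = begin
    x ℤ.- A u u  ≡⟨ cong (ℤ._-_ x) (proj₂ (adj u u) λ u~u → proj₁ u~u refl) ⟩
    x ℤ.+ ℤ.0ℤ   ≡⟨ ℤₚ.+-identityʳ x ⟩
    x            ≡⟨ sym (charEntry-diag m x (toℕ u)) ⟩
    charEntry m x (toℕ u) (toℕ u) ∎
  ... | no u≢v = byEdge (edge? m (toℕ u) (toℕ v))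
    where
    a<2m = toℕ<m+m u
    b<2m = toℕ<m+m v
    a≢b : toℕ u ≢ toℕ v
    a≢b = u≢v ∘ Finₚ.toℕ-injective
    byEdge : Dec (Edge m (toℕ u) (toℕ v)) → ℤ.- A u v ≡ charEntry m x (toℕ u) (toℕ v)
    byEdge (yes edge) = trans (cong ℤ.-_ (proj₁ (adj u v) (u≢v , edge⇒related a<2m b<2m edge)))
                              (sym (charEntry-edge m x a≢b edge))
    byEdge (no ¬edge) = trans (cong ℤ.-_ (proj₂ (adj u v) (¬edge⇒¬related a<2m b<2m a≢b ¬edge ∘ proj₂)))
                              (sym (charEntry-nonEdge m x a≢b ¬edge))

open import Data.Nat using (ℕ; _≤_; _^_; _∸_) renaming (_*_ to _*ℕ_)
open import Data.Fin using (Fin)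
open import Data.Integer using (ℤ; +_; _+_; _-_; _*_; 1ℤ)
open import Relation.Binary.PropositionalEquality using (_≡_)

open import Data.Nat using (suc; s≤s)
open import Data.Nat.Properties using (+-identityʳ; m≤m*n; m^n≢0; ^-distribˡ-+-*)
open import Data.Nat.Tactic.RingSolver using (solve-∀)
open import Relation.Binary.PropositionalEquality using (cong; trans)
open PowerGraphMatrix using (det-charEntry)

2^[2n∸2]≡[2^[n∸1]]² : ∀ k → 2 ^ ((2 *ℕ suc (suc k)) ∸ 2) ≡ 2 ^ suc k *ℕ 2 ^ suc k
2^[2n∸2]≡[2^[n∸1]]² k = trans (cong (2 ^_) (exponent k)) (^-distribˡ-+-* 2 (suc k) (suc k))
  where exponent : ∀ k → k Data.Nat.+ (suc (suc k) Data.Nat.+ 0) ≡ suc k Data.Nat.+ suc k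
        exponent = solve-∀

-- only n ≥ 2 is used
mainTheorem8 : (n : ℕ) → 3 ≤ n →
    (A : Fin (2 ^ n) → Fin (2 ^ n) → ℤ) → IsAdjMatrix n A →
    (x : ℤ) →
      det (charMat x A) ≡
        (x Data.Integer.^ (2 ^ (n ∸ 1) ∸ 1)) * ((1ℤ + x) Data.Integer.^ (2 ^ (n ∸ 1) ∸ 2))
        * ((x Data.Integer.^ 3) + ((+ 2) - (+ (2 ^ (n ∸ 1)))) * (x Data.Integer.^ 2)
           + (1ℤ - (+ (2 ^ n))) * x + ((+ (2 ^ ((2 *ℕ n) ∸ 2))) - (+ (2 ^ n))))
mainTheorem8 (suc (suc k)) (s≤s (s≤s _)) A adj x rewrite 2^[2n∸2]≡[2^[n∸1]]² k =
  det-charEntry m x 2≤m (cong (m Data.Nat.+_) (+-identityʳ m)) (charMat x A) (charMat≡charEntry x A adj)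
  where
  open PowerGraph k using (m; charMat≡charEntry)
  2≤m : 2 ≤ m
  2≤m = m≤m*n 2 (2 ^ k) {{m^n≢0 2 k}}
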